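{- Let $G$ be a connected graph of order $n\geq 2$ and $p$ an integer with $1\le p\le \frac{n}{2}-1$. Then $$\left\lceil\frac{2(n+p)}{3}\right\rceil\le \gamma_t(M(G+\overline{K_p}))\le 2p+\min\{\gamma_t(M(G[A])) : A\subseteq V(G),\ |A|=n-2p,\ G[A] \text{ has no isolated vertices}\}.$$
   Context: All graphs are finite and simple. $G[A]$ is the subgraph of $G$ induced on $A$. $\overline{K_p}$ denotes the edgeless graph on $p$ vertices. The join $G+H$ of graphs $G,H$ (on disjoint vertex sets) has vertex set $V(G)\cup V(H)$ and edge set $E(G)\cup E(H)\cup\{vw : v\in V(G), w\in V(H)\}$. For a graph $H$ with no isolated vertices, a total dominating set of $H$ is a set $S\subseteq V(H)$ such that every vertex of $H$ has at least one neighbor in $S$; $\gamma_t(H)$ is the minimum cardinality of a total dominating set. The middle graph $M(G)$ of a graph $G$ has vertex set $V(G)\cup E(G)$ (disjoint union), and two of its vertices $x,y$ are adjacent exactly when either $x,y\in E(G)$ are edges of $G$ sharing a common endpoint, or $x\in V(G)$, $y\in E(G)$ and $x$ is an endpoint of $y$ (no two elements of $V(G)$ are adjacent in $M(G)$). -}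

module Defs where

open import Data.Nat using (ℕ; _+_; _*_; _≤_; _∸_)
open import Data.Nat.DivMod using (_/_)
open import Data.Fin using (Fin; splitAt) renaming (_<_ to _<ᶠ_)
open import Data.Bool using (Bool; true; false; T)
open import Data.Sum using (_⊎_; inj₁; inj₂)
open import Data.Product using (Σ; ∃; _×_; _,_; proj₁; proj₂)
open import Data.Empty using (⊥)
open import Data.List using (List; length)
open import Data.List.Membership.Propositional using (_∈_)
open import Data.List.Relation.Unary.Unique.Propositional using (Unique)
open import Relation.Binary.PropositionalEquality using (_≡_; _≢_)
open import Function.Definitions using (Injective)

record SimpleGraph (n : ℕ) : Set where
  field
    adj   : Fin n → Fin n → Bool
    sym   : ∀ i j → adj i j ≡ adj j i
    irref : ∀ i → adj i i ≡ false
open SimpleGraph public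

Adj : ∀ {n} → SimpleGraph n → Fin n → Fin n → Set
Adj G i j = T (adj G i j)

data Reach {n} (G : SimpleGraph n) : Fin n → Fin n → Set where
  here : ∀ {i} → Reach G i i
  step : ∀ {i k j} → Adj G i k → Reach G k j → Reach G i j

Connected : ∀ {n} → SimpleGraph n → Set
Connected {n} G = ∀ (i j : Fin n) → Reach G i j

-- Edge set: each edge {i,j} represented uniquely by the pair (i , j), i < j.
Edge : ∀ {n} → SimpleGraph n → Set
Edge {n} G = Σ (Fin n × Fin n) λ ij → (proj₁ ij <ᶠ proj₂ ij) × Adj G (proj₁ ij) (proj₂ ij)

_isEndOf_ : ∀ {n} {G : SimpleGraph n} → Fin n → Edge G → Set
v isEndOf ((i , j) , _) = (v ≡ i) ⊎ (v ≡ j)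

ShareEnd : ∀ {n} {G : SimpleGraph n} → Edge G → Edge G → Set
ShareEnd {G = G} e f = Σ _ λ v → (_isEndOf_ {G = G} v e) × (_isEndOf_ {G = G} v f)

record Graph : Set₁ where
  field
    V    : Set
    _~_  : V → V → Set
open Graph public

MAdj : ∀ {n} (G : SimpleGraph n) → (Fin n ⊎ Edge G) → (Fin n ⊎ Edge G) → Set
MAdj G (inj₁ v) (inj₁ w) = ⊥
MAdj G (inj₁ v) (inj₂ e) = _isEndOf_ {G = G} v e
MAdj G (inj₂ e) (inj₁ v) = _isEndOf_ {G = G} v e
MAdj G (inj₂ e) (inj₂ f) = (proj₁ e ≢ proj₁ f) × ShareEnd {G = G} e f

Middle : ∀ {n} → SimpleGraph n → Graph
Middle {n} G = record { V = Fin n ⊎ Edge G ; _~_ = MAdj G }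

IsTotalDominating : (H : Graph) → List (V H) → Set
IsTotalDominating H S = Unique S × (∀ (v : V H) → ∃ λ u → (u ∈ S) × (_~_ H v u))

IsGammaT : Graph → ℕ → Set
IsGammaT H k =
  (Σ (List (V H)) λ S → IsTotalDominating H S × length S ≡ k)
  × (∀ (S : List (V H)) → IsTotalDominating H S → k ≤ length S)

-- Join G + (edgeless graph on p vertices), on Fin (n + p):
-- the first n vertices are those of G, the last p those of K̄_p.

joinAdj : ∀ {n} (p : ℕ) → SimpleGraph n → Fin (n + p) → Fin (n + p) → Bool
joinAdj {n} p G x y with splitAt n x | splitAt n y
... | inj₁ i | inj₁ j = adj G i j
... | inj₁ _ | inj₂ _ = true
... | inj₂ _ | inj₁ _ = true
... | inj₂ _ | inj₂ _ = false

joinAdj-sym : ∀ {n} (p : ℕ) (G : SimpleGraph n) x y → joinAdj p G x y ≡ joinAdj p G y x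
joinAdj-sym {n} p G x y with splitAt n x | splitAt n y
... | inj₁ i | inj₁ j = sym G i j
... | inj₁ _ | inj₂ _ = Relation.Binary.PropositionalEquality.refl
... | inj₂ _ | inj₁ _ = Relation.Binary.PropositionalEquality.refl
... | inj₂ _ | inj₂ _ = Relation.Binary.PropositionalEquality.refl

joinAdj-irr : ∀ {n} (p : ℕ) (G : SimpleGraph n) x → joinAdj p G x x ≡ false
joinAdj-irr {n} p G x with splitAt n x
... | inj₁ i = irref G i
... | inj₂ _ = Relation.Binary.PropositionalEquality.refl

JoinEmpty : ∀ {n} → SimpleGraph n → (p : ℕ) → SimpleGraph (n + p)
JoinEmpty G p = record { adj = joinAdj p G ; sym = joinAdj-sym p G ; irref = joinAdj-irr p G }

-- Induced subgraph G[A], where the m-subset A ⊆ V(G) is given as the image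
-- of an injection f : Fin m → Fin n (G[A] is taken on Fin m via f).

Induced : ∀ {n m} → SimpleGraph n → (Fin m → Fin n) → SimpleGraph m
Induced G f = record
  { adj = λ i j → adj G (f i) (f j)
  ; sym = λ i j → sym G (f i) (f j)
  ; irref = λ i → irref G (f i) }

NoIsolated : ∀ {n} → SimpleGraph n → Set
NoIsolated {n} G = ∀ (i : Fin n) → ∃ λ j → Adj G i j

ceil/3 : ℕ → ℕ
ceil/3 a = (a + 2) / 3

-- Every vertex v of H is dominated in M(H) by an edge chosen v ∈ S at v.  Give each vertex
-- two tokens and each element of S three slots.  An edge g ∈ S holds the first token of every end that
-- chose it, plus one second token of such an end; so a full edge e (chosen by both ends) leaves one second
-- token over.  That token goes to a dominator r of e in M(H), which has a free slot: either r is an end of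
-- e, whose only slot is otherwise empty, or r is an edge meeting e at an end x that chose e ≠ r, and then
-- r's slot at x is unused.  Every token lies in a slot, hence 2|V(H)| ≤ 3|S|.
--
-- A total dominating set of M(G[A]), copied into M(G + K̄p), dominates the vertices of A and
-- the edges inside A.  The 2p vertices outside A are paired up and each pair is joined to its own vertex of
-- K̄p; these 2p edges dominate everything else.

module Submission where

open import Defs hiding (sym)
open import Data.Nat using (ℕ; suc; _+_; _*_; _≤_; _∸_; z≤n; s≤s)
open import Data.Nat.DivMod using (m<n*o⇒m/o<n)
open import Data.Nat.Properties
  using (+-suc; +-comm; *-comm; *-suc; +-identityʳ; suc-injective; +-cancelˡ-≡; ≤-antisym; ≤-trans; ≤-reflexive;
         ≤-pred; m≤m+n; n<1+n; m∸n+n≡m; +-mono-≤; +-monoˡ-≤; +-monoʳ-≤)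
open import Data.Fin using (Fin; _↑ˡ_; _↑ʳ_; splitAt; toℕ) renaming (_<_ to _<ᶠ_)
import Data.Fin as F
import Data.Fin.Properties as FP
open import Data.Bool using (true; T)
open import Data.Bool.Properties using (T-irrelevant)
open import Data.Maybe using (Maybe; just; nothing)
import Data.Maybe.Relation.Unary.Any as MAny
open import Data.Sum using (_⊎_; inj₁; inj₂)
import Data.Sum as Sum
import Data.Sum.Properties as SumP
open import Data.Product using (Σ; ∃; ∃₂; _×_; _,_; proj₁; proj₂)
import Data.Product.Properties as ProdP
open import Data.Empty using (⊥-elim)
open import Data.List using (List; []; _∷_; _++_; length; map; filter; concatMap; mapMaybe; allFin; deduplicate)
open import Data.List.Properties using (length-++; length-map; length-mapMaybe; length-tabulate; length-deduplicate)
import Data.List.Relation.Unary.Unique.DecPropositional.Properties as UDP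
import Data.List.Relation.Unary.Unique.Propositional.Properties as UP
open import Data.List.Membership.Propositional using (_∈_)
open import Data.List.Membership.Propositional.Properties
  using (∈-∃++; ∈-concatMap⁺; ∈-filter⁺; ∈-filter⁻; ∈-allFin; ∈-map⁺; ∈-map⁻; ∈-++⁺ˡ; ∈-++⁺ʳ;
         ∈-deduplicate⁺)
open import Data.List.Relation.Unary.Any using (here; there)
import Data.List.Relation.Unary.Any as Any
import Data.List.Relation.Unary.Any.Properties as AnyP
open import Data.List.Relation.Unary.All using (_∷_)
import Data.List.Relation.Unary.All as All
open import Data.List.Relation.Unary.Unique.Propositional using (Unique)
open import Data.List.Relation.Unary.AllPairs using (_∷_)
open import Relation.Binary.Definitions using (DecidableEquality; tri<; tri≈; tri>)
open import Relation.Binary.PropositionalEquality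
open import Function using (id; _∘_)
open import Function.Definitions using (Injective)
open import Relation.Nullary using (Dec; yes; no; ¬_; ¬?)
open import Relation.Nullary.Decidable using (_×-dec_)

module _ {A : Set} where

  ∈-delete : ∀ {x z : A} ys zs → z ∈ ys ++ x ∷ zs → z ≢ x → z ∈ ys ++ zs
  ∈-delete []       zs (here z≡x) z≢x = ⊥-elim (z≢x z≡x)
  ∈-delete []       zs (there z∈) z≢x = z∈
  ∈-delete (y ∷ ys) zs (here z≡y) z≢x = here z≡y
  ∈-delete (y ∷ ys) zs (there z∈) z≢x = there (∈-delete ys zs z∈ z≢x)

  unique∧⊆⇒length≤ : ∀ (xs ys : List A) → Unique xs → (∀ {z} → z ∈ xs → z ∈ ys) →
                     length xs ≤ length ys
  unique∧⊆⇒length≤ []       ys _             _  = z≤n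
  unique∧⊆⇒length≤ (x ∷ xs) ys (x∉xs ∷ !xs) xs⊆ys with ∈-∃++ (xs⊆ys (here refl))
  ... | ys₁ , ys₂ , refl = begin
    suc (length xs)                   ≤⟨ s≤s (unique∧⊆⇒length≤ xs (ys₁ ++ ys₂) !xs xs⊆ys₁ys₂) ⟩
    suc (length (ys₁ ++ ys₂))         ≡⟨ cong suc (length-++ ys₁) ⟩
    suc (length ys₁ + length ys₂)     ≡⟨ +-suc (length ys₁) (length ys₂) ⟨
    length ys₁ + length (x ∷ ys₂)     ≡⟨ length-++ ys₁ ⟨
    length (ys₁ ++ x ∷ ys₂)           ∎
    where
    open Data.Nat.Properties.≤-Reasoning
    xs⊆ys₁ys₂ : ∀ {z} → z ∈ xs → z ∈ ys₁ ++ ys₂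
    xs⊆ys₁ys₂ z∈xs = ∈-delete ys₁ ys₂ (xs⊆ys (there z∈xs)) λ { refl → All.lookup x∉xs z∈xs refl }

  ∈-mapMaybe⁺ : ∀ {B : Set} (f : A → Maybe B) {x y xs} → x ∈ xs → f x ≡ just y → y ∈ mapMaybe f xs
  ∈-mapMaybe⁺ f x∈xs fx≡y = AnyP.mapMaybe⁺ f _ (AnyP.map⁺ (Any.map just-y x∈xs))
    where
    just-y : ∀ {x} → _ ≡ x → MAny.Any (_ ≡_) (f x)
    just-y refl = subst (MAny.Any (_ ≡_)) (sym fx≡y) (MAny.just refl)

  length-concatMap≤ : ∀ {B : Set} (f : A → List B) {k} → (∀ x → length (f x) ≤ k) →
                      ∀ xs → length (concatMap f xs) ≤ k * length xs
  length-concatMap≤ f f≤k []       = z≤n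
  length-concatMap≤ f {k} f≤k (x ∷ xs) rewrite length-++ (f x) {concatMap f xs} | *-suc k (length xs) =
    +-mono-≤ (f≤k x) (length-concatMap≤ f f≤k xs)

TotallyDominates : (H : Graph) → List (V H) → Set
TotallyDominates H S = ∀ (v : V H) → ∃ λ u → u ∈ S × _~_ H v u

γₜ≤length : ∀ {H k} → IsGammaT H k → DecidableEquality (V H) →
            ∀ T → TotallyDominates H T → k ≤ length T
γₜ≤length (_ , minimal) _≟_ T dom =
  ≤-trans (minimal (deduplicate _≟_ T) (UDP.deduplicate-! _≟_ T , dedup-dom)) (length-deduplicate _≟_ T)
  where
  dedup-dom : TotallyDominates _ (deduplicate _≟_ T)
  dedup-dom v with dom v
  ... | u , u∈T , vu = u , ∈-deduplicate⁺ _≟_ u∈T , vu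

module Edges {N : ℕ} (H : SimpleGraph N) where

  _∈ₑ_ : Fin N → Edge H → Set
  v ∈ₑ e = _isEndOf_ {G = H} v e

  adj⇒≢ : ∀ {x y} → Adj H x y → x ≢ y
  adj⇒≢ {x} xy refl = subst T (irref H x) xy

  edge-≡ : ∀ (e f : Edge H) → proj₁ e ≡ proj₁ f → e ≡ f
  edge-≡ (_ , lt , xy) (_ , lt′ , xy′) refl rewrite FP.<-irrelevant lt lt′ | T-irrelevant xy xy′ = refl

  _≟ᴱ_ : DecidableEquality (Edge H)
  e ≟ᴱ f with ProdP.≡-dec F._≟_ F._≟_ (proj₁ e) (proj₁ f)
  ... | yes e≡f = yes (edge-≡ e f e≡f)
  ... | no  e≢f = no λ { refl → e≢f refl }

  _≟ᴹ_ : DecidableEquality (Fin N ⊎ Edge H)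
  _≟ᴹ_ = SumP.≡-dec F._≟_ _≟ᴱ_

  edgeBetween : ∀ x y → Adj H x y → Edge H
  edgeBetween x y xy with FP.<-cmp x y
  ... | tri< x<y _ _ = (x , y) , x<y , xy
  ... | tri≈ _ x≡y _ = ⊥-elim (adj⇒≢ xy x≡y)
  ... | tri> _ _ y<x = (y , x) , y<x , subst T (SimpleGraph.sym H x y) xy

  edgeBetween-end⁺ : ∀ x y (xy : Adj H x y) {v} → (v ≡ x) ⊎ (v ≡ y) → v ∈ₑ edgeBetween x y xy
  edgeBetween-end⁺ x y xy with FP.<-cmp x y
  ... | tri< _ _ _   = id
  ... | tri≈ _ x≡y _ = ⊥-elim (adj⇒≢ xy x≡y)
  ... | tri> _ _ _   = Sum.swap

  edgeBetween-end⁻ : ∀ x y (xy : Adj H x y) {v} → v ∈ₑ edgeBetween x y xy → (v ≡ x) ⊎ (v ≡ y)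
  edgeBetween-end⁻ x y xy with FP.<-cmp x y
  ... | tri< _ _ _   = id
  ... | tri≈ _ x≡y _ = ⊥-elim (adj⇒≢ xy x≡y)
  ... | tri> _ _ _   = Sum.swap

  edge-unique : ∀ {x y} (e f : Edge H) → x ≢ y →
                x ∈ₑ e → y ∈ₑ e →
                x ∈ₑ f → y ∈ₑ f → e ≡ f
  edge-unique e f x≢y (inj₁ refl) (inj₁ refl) _ _ = ⊥-elim (x≢y refl)
  edge-unique e f x≢y (inj₂ refl) (inj₂ refl) _ _ = ⊥-elim (x≢y refl)
  edge-unique e f x≢y _ _ (inj₁ refl) (inj₁ refl) = ⊥-elim (x≢y refl)
  edge-unique e f x≢y _ _ (inj₂ refl) (inj₂ refl) = ⊥-elim (x≢y refl)
  edge-unique e f x≢y (inj₁ refl) (inj₂ refl) (inj₁ refl) (inj₂ refl) = edge-≡ e f refl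
  edge-unique e f x≢y (inj₂ refl) (inj₁ refl) (inj₂ refl) (inj₁ refl) = edge-≡ e f refl
  edge-unique (_ , a<b , _) (_ , b<a , _) _ (inj₁ refl) (inj₂ refl) (inj₂ refl) (inj₁ refl) =
    ⊥-elim (FP.<-asym a<b b<a)
  edge-unique (_ , b<a , _) (_ , a<b , _) _ (inj₂ refl) (inj₁ refl) (inj₁ refl) (inj₂ refl) =
    ⊥-elim (FP.<-asym b<a a<b)

data Split (m n : ℕ) : Fin (m + n) → Set where
  inˡ : (i : Fin m) → Split m n (i ↑ˡ n)
  inʳ : (j : Fin n) → Split m n (m ↑ʳ j)

split : ∀ m n i → Split m n i
split m n i with splitAt m i in eq
... | inj₁ a = subst (Split m n) (FP.splitAt⁻¹-↑ˡ eq) (inˡ a)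
... | inj₂ u = subst (Split m n) (FP.splitAt⁻¹-↑ʳ eq) (inʳ u)

module MiddleCharging {N : ℕ} (H : SimpleGraph N) (S : List (Fin N ⊎ Edge H))
                      (dom : TotallyDominates (Middle H) S) where

  open Edges H

  Token : Set
  Token = Fin (N + N)

  first second : Fin N → Token
  first  v = v ↑ˡ N
  second v = N ↑ʳ v

  data Slot : Set where
    left middle right : Slot

  slots : List Slot
  slots = left ∷ middle ∷ right ∷ []

  ∈-slots : ∀ σ → σ ∈ slots
  ∈-slots left   = here refl
  ∈-slots middle = there (here refl)
  ∈-slots right  = there (there (here refl))

  chosenAt : ∀ v → Σ (Edge H) λ e → inj₂ e ∈ S × v ∈ₑ e
  chosenAt v with dom (inj₁ v)
  ... | inj₂ e , e∈S , v∈e = e , e∈S , v∈e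

  chosen : Fin N → Edge H
  chosen v = proj₁ (chosenAt v)

  endˡ endʳ : Edge H → Fin N
  endˡ e = proj₁ (proj₁ e)
  endʳ e = proj₂ (proj₁ e)

  Full : Edge H → Set
  Full e = chosen (endˡ e) ≡ e × chosen (endʳ e) ≡ e

  full-chosen : ∀ {e v} → Full e → v ∈ₑ e → chosen v ≡ e
  full-chosen (chosenA , _) (inj₁ refl) = chosenA
  full-chosen (_ , chosenB) (inj₂ refl) = chosenB

  rescuer : Edge H → Fin N ⊎ Edge H
  rescuer e = proj₁ (dom (inj₂ e))

  Rescues : Edge H → Fin N ⊎ Edge H → Set
  Rescues e s = Full e × rescuer e ≡ s

  rescues? : ∀ e s → Dec (Rescues e s)
  rescues? e s = ((chosen (endˡ e) ≟ᴱ e) ×-dec (chosen (endʳ e) ≟ᴱ e)) ×-dec (rescuer e ≟ᴹ s)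

  rescue : Edge H → Fin N ⊎ Edge H → Maybe Token
  rescue e s with rescues? e s
  ... | yes _ = just (second (endʳ e))
  ... | no  _ = nothing

  endOccupant : Edge H → Fin N → Maybe Token
  endOccupant g x with chosen x ≟ᴱ g
  ... | yes _ = just (first x)
  ... | no  _ = rescue (chosen x) (inj₂ g)

  middleOccupant : Edge H → Maybe Token
  middleOccupant g with chosen (endˡ g) ≟ᴱ g | chosen (endʳ g) ≟ᴱ g
  ... | yes _ | _     = just (second (endˡ g))
  ... | no  _ | yes _ = just (second (endʳ g))
  ... | no  _ | no  _ = nothing

  occupant : Fin N ⊎ Edge H → Slot → Maybe Token
  occupant (inj₁ w) left   = rescue (chosen w) (inj₁ w)
  occupant (inj₁ w) _      = nothing
  occupant (inj₂ g) left   = endOccupant g (endˡ g)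
  occupant (inj₂ g) middle = middleOccupant g
  occupant (inj₂ g) right  = endOccupant g (endʳ g)

  chargesOf : Fin N ⊎ Edge H → List Token
  chargesOf s = mapMaybe (occupant s) slots

  charges : List Token
  charges = concatMap chargesOf S

  length-charges : length charges ≤ 3 * length S
  length-charges = length-concatMap≤ chargesOf (λ s → length-mapMaybe (occupant s) slots) S

  charged : ∀ {s t} σ → s ∈ S → occupant s σ ≡ just t → t ∈ charges
  charged {s} σ s∈S occ =
    ∈-concatMap⁺ chargesOf (Any.map (λ { refl → ∈-mapMaybe⁺ (occupant s) (∈-slots σ) occ }) s∈S)

  rescue-hit : ∀ {e s} → Rescues e s → rescue e s ≡ just (second (endʳ e))
  rescue-hit {e} {s} r with rescues? e s
  ... | yes _ = refl
  ... | no ¬r = ⊥-elim (¬r r)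

  endOccupant-chosen : ∀ {g x} → chosen x ≡ g → endOccupant g x ≡ just (first x)
  endOccupant-chosen {g} {x} c with chosen x ≟ᴱ g
  ... | yes _ = refl
  ... | no ¬c = ⊥-elim (¬c c)

  endOccupant-unchosen : ∀ {g x} → chosen x ≢ g → endOccupant g x ≡ rescue (chosen x) (inj₂ g)
  endOccupant-unchosen {g} {x} ¬c with chosen x ≟ᴱ g
  ... | yes c = ⊥-elim (¬c c)
  ... | no  _ = refl

  middleOccupant-ˡ : ∀ {g} → chosen (endˡ g) ≡ g → middleOccupant g ≡ just (second (endˡ g))
  middleOccupant-ˡ {g} c with chosen (endˡ g) ≟ᴱ g
  ... | yes _ = refl
  ... | no ¬c = ⊥-elim (¬c c)

  middleOccupant-ʳ : ∀ {g} → chosen (endˡ g) ≢ g → chosen (endʳ g) ≡ g →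
                     middleOccupant g ≡ just (second (endʳ g))
  middleOccupant-ʳ {g} ¬cˡ cʳ with chosen (endˡ g) ≟ᴱ g | chosen (endʳ g) ≟ᴱ g
  ... | yes cˡ | _     = ⊥-elim (¬cˡ cˡ)
  ... | no _   | yes _ = refl
  ... | no _   | no ¬cʳ = ⊥-elim (¬cʳ cʳ)

  endOccupant-rescuing : ∀ {e g x} → Full e → x ∈ₑ e → proj₁ e ≢ proj₁ g → rescuer e ≡ inj₂ g →
                         endOccupant g x ≡ just (second (endʳ e))
  endOccupant-rescuing {e} {g} {x} full x∈e e≢g rescuer≡g = begin
    endOccupant g x             ≡⟨ endOccupant-unchosen (λ x↦g → e≢g (cong proj₁ (trans (sym x↦e) x↦g))) ⟩
    rescue (chosen x) (inj₂ g)  ≡⟨ cong (λ c → rescue c (inj₂ g)) x↦e ⟩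
    rescue e (inj₂ g)           ≡⟨ rescue-hit (full , rescuer≡g) ⟩
    just (second (endʳ e))      ∎
    where
    open ≡-Reasoning
    x↦e : chosen x ≡ e
    x↦e = full-chosen full x∈e

  rescuer-charged : ∀ e → Full e → ∀ r → r ∈ S → MAdj H (inj₂ e) r → rescuer e ≡ r →
                    second (endʳ e) ∈ charges
  rescuer-charged e full (inj₁ w) r∈S w∈e rescuer≡w =
    charged left r∈S (trans (cong (λ c → rescue c (inj₁ w)) (full-chosen full w∈e)) (rescue-hit (full , rescuer≡w)))
  rescuer-charged e full (inj₂ g) r∈S (e≢g , w , w∈e , inj₁ refl) rescuer≡g =
    charged left r∈S (endOccupant-rescuing full w∈e e≢g rescuer≡g)
  rescuer-charged e full (inj₂ g) r∈S (e≢g , w , w∈e , inj₂ refl) rescuer≡g =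
    charged right r∈S (endOccupant-rescuing full w∈e e≢g rescuer≡g)

  full-edge-second-token : ∀ e → Full e → second (endʳ e) ∈ charges
  full-edge-second-token e full with dom (inj₂ e) in eq
  ... | r , r∈S , er = rescuer-charged e full r r∈S er (cong proj₁ eq)

  end-tokens : ∀ e → inj₂ e ∈ S → ∀ {x} → x ∈ₑ e → chosen x ≡ e →
               first x ∈ charges × second x ∈ charges
  end-tokens e e∈S (inj₁ refl) x↦e =
    charged left e∈S (endOccupant-chosen x↦e) , charged middle e∈S (middleOccupant-ˡ x↦e)
  end-tokens e e∈S (inj₂ refl) x↦e = charged right e∈S (endOccupant-chosen x↦e) , second-token
    where
    second-token : second (endʳ e) ∈ charges
    second-token with chosen (endˡ e) ≟ᴱ e
    ... | yes l↦e = full-edge-second-token e (l↦e , x↦e)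
    ... | no  l↛e = charged middle e∈S (middleOccupant-ʳ l↛e x↦e)

  all-charged : ∀ t → t ∈ charges
  all-charged t with split N N t
  ... | inˡ v = proj₁ (end-tokens (chosen v) (proj₁ (proj₂ (chosenAt v))) (proj₂ (proj₂ (chosenAt v))) refl)
  ... | inʳ v = proj₂ (end-tokens (chosen v) (proj₁ (proj₂ (chosenAt v))) (proj₂ (proj₂ (chosenAt v))) refl)

middle-domination-lower-bound : ∀ {N} (H : SimpleGraph N) (S : List (Fin N ⊎ Edge H)) →
                                TotallyDominates (Middle H) S → 2 * N ≤ 3 * length S
middle-domination-lower-bound {N} H S dom = begin
  2 * N                       ≡⟨ cong (N +_) (+-identityʳ N) ⟩
  N + N                       ≡⟨ length-tabulate {n = N + N} id ⟨
  length (allFin (N + N))     ≤⟨ unique∧⊆⇒length≤ _ charges (UP.allFin⁺ (N + N)) (λ _ → all-charged _) ⟩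
  length charges              ≤⟨ length-charges ⟩
  3 * length S                ∎
  where
  open MiddleCharging H S dom
  open Data.Nat.Properties.≤-Reasoning

module EdgeMap {m N : ℕ} (H : SimpleGraph m) (K : SimpleGraph N) (h : Fin m → Fin N)
               (h-injective : Injective _≡_ _≡_ h) (h-adj : ∀ {i j} → Adj H i j → Adj K (h i) (h j)) where

  open Edges H using () renaming (_∈ₑ_ to _∈ᴴ_)
  open Edges K using (edgeBetween; edgeBetween-end⁺; edgeBetween-end⁻) renaming (_∈ₑ_ to _∈ᴷ_)

  mapEdge : Edge H → Edge K
  mapEdge ((i , j) , _ , ij) = edgeBetween (h i) (h j) (h-adj ij)

  mapEdge-end : ∀ {v} g → v ∈ᴴ g → h v ∈ᴷ mapEdge g
  mapEdge-end ((i , j) , _ , ij) v∈g = edgeBetween-end⁺ (h i) (h j) (h-adj ij) (Sum.map (cong h) (cong h) v∈g)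

  mapEdge-end⁻ : ∀ {v} g → h v ∈ᴷ mapEdge g → v ∈ᴴ g
  mapEdge-end⁻ ((i , j) , _ , ij) hv∈hg =
    Sum.map h-injective h-injective (edgeBetween-end⁻ (h i) (h j) (h-adj ij) hv∈hg)

  mapEdge-injective : Injective _≡_ _≡_ mapEdge
  mapEdge-injective {g@((i , j) , i<j , _)} {g′} hg≡hg′ =
    Edges.edge-unique H g g′ (λ i≡j → FP.<-irrefl i≡j i<j) (inj₁ refl) (inj₂ refl)
      (mapEdge-end⁻ g′ (subst (h i ∈ᴷ_) hg≡hg′ (mapEdge-end g (inj₁ refl))))
      (mapEdge-end⁻ g′ (subst (h j ∈ᴷ_) hg≡hg′ (mapEdge-end g (inj₂ refl))))

  mapMiddle : Fin m ⊎ Edge H → Fin N ⊎ Edge K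
  mapMiddle = Sum.map h mapEdge

  mapMiddle-adj : ∀ s t → MAdj H s t → MAdj K (mapMiddle s) (mapMiddle t)
  mapMiddle-adj (inj₁ v) (inj₂ g) v∈g = mapEdge-end g v∈g
  mapMiddle-adj (inj₂ g) (inj₁ v) v∈g = mapEdge-end g v∈g
  mapMiddle-adj (inj₂ g) (inj₂ g′) (g≢g′ , w , w∈g , w∈g′) =
    hg≢hg′ , h w , mapEdge-end g w∈g , mapEdge-end g′ w∈g′
    where
    hg≢hg′ : proj₁ (mapEdge g) ≢ proj₁ (mapEdge g′)
    hg≢hg′ = g≢g′ ∘ cong proj₁ ∘ mapEdge-injective {g} {g′} ∘ Edges.edge-≡ K (mapEdge g) (mapEdge g′)

module ImageComplement {m n : ℕ} (f : Fin m → Fin n) (f-injective : Injective _≡_ _≡_ f) where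

  Image : Fin n → Set
  Image a = ∃ λ i → f i ≡ a

  image? : ∀ a → Dec (Image a)
  image? a = FP.any? (λ i → f i F.≟ a)

  complement : List (Fin n)
  complement = filter (¬? ∘ image?) (allFin n)

  ∈-complement : ∀ {a} → ¬ Image a → a ∈ complement
  ∈-complement a∉f = ∈-filter⁺ (¬? ∘ image?) (∈-allFin _) a∉f

  complement-unique : Unique complement
  complement-unique = UP.filter⁺ (¬? ∘ image?) (UP.allFin⁺ n)

  length-complement : m + length complement ≡ n
  length-complement = ≤-antisym image+complement≤n n≤image+complement
    where
    image : List (Fin n)
    image = map f (allFin m)

    length-image+complement : length (image ++ complement) ≡ m + length complement
    length-image+complement
      rewrite length-++ image {complement} | length-map f (allFin m) | length-tabulate {n = m} id = refl

    image+complement-unique : Unique (image ++ complement)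
    image+complement-unique = UP.++⁺ (UP.map⁺ f-injective (UP.allFin⁺ m)) complement-unique disjoint
      where
      disjoint : ∀ {a} → ¬ (a ∈ image × a ∈ complement)
      disjoint (a∈image , a∈complement) with ∈-map⁻ f a∈image
      ... | i , _ , refl = proj₂ (∈-filter⁻ (¬? ∘ image?) {xs = allFin n} a∈complement) (i , refl)

    image+complement≤n : m + length complement ≤ n
    image+complement≤n = subst₂ _≤_ length-image+complement (length-tabulate {n = n} id)
      (unique∧⊆⇒length≤ (image ++ complement) (allFin n) image+complement-unique (λ _ → ∈-allFin _))

    n≤image+complement : n ≤ m + length complement
    n≤image+complement = subst₂ _≤_ (length-tabulate {n = n} id) length-image+complement
      (unique∧⊆⇒length≤ (allFin n) (image ++ complement) (UP.allFin⁺ n) covers)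
      where
      covers : ∀ {a} → a ∈ allFin n → a ∈ image ++ complement
      covers {a} _ with image? a
      ... | yes (i , refl) = ∈-++⁺ˡ (∈-map⁺ f (∈-allFin i))
      ... | no  a∉f        = ∈-++⁺ʳ image (∈-complement a∉f)

module JoinCover {n : ℕ} (G : SimpleGraph n) (p : ℕ) where

  G+K̄p : SimpleGraph (n + p)
  G+K̄p = JoinEmpty G p

  open Edges G+K̄p using (_∈ₑ_; _≟ᴱ_; edge-≡; edge-unique)

  joinAdj-↑ˡ : ∀ a b → adj G+K̄p (a ↑ˡ p) (b ↑ˡ p) ≡ adj G a b
  joinAdj-↑ˡ a b rewrite FP.splitAt-↑ˡ n a p | FP.splitAt-↑ˡ n b p = refl

  joinAdj-cross : ∀ a u → adj G+K̄p (a ↑ˡ p) (n ↑ʳ u) ≡ true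
  joinAdj-cross a u rewrite FP.splitAt-↑ˡ n a p | FP.splitAt-↑ʳ n p u = refl

  ↑ˡ≢↑ʳ : ∀ (a : Fin n) (u : Fin p) → a ↑ˡ p ≢ n ↑ʳ u
  ↑ˡ≢↑ʳ a u eq with trans (sym (FP.splitAt-↑ˡ n a p)) (trans (cong (splitAt n) eq) (FP.splitAt-↑ʳ n p u))
  ... | ()

  crossEdge : Fin n → Fin p → Edge G+K̄p
  crossEdge a u = (a ↑ˡ p , n ↑ʳ u) , a<u , subst T (sym (joinAdj-cross a u)) _
    where
    a<u : (a ↑ˡ p) <ᶠ (n ↑ʳ u)
    a<u rewrite FP.toℕ-↑ˡ a p | FP.toℕ-↑ʳ n u = ≤-trans (FP.toℕ<n a) (m≤m+n n (toℕ u))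

  spokes : List (Fin p) → List (Fin n) → List (Fin (n + p) ⊎ Edge G+K̄p)
  spokes (u ∷ us) (a ∷ b ∷ L) = inj₂ (crossEdge a u) ∷ inj₂ (crossEdge b u) ∷ spokes us L
  spokes _        _           = []

  length-spokes : ∀ us L → length (spokes us L) ≤ 2 * length us
  length-spokes []       L           = z≤n
  length-spokes (u ∷ us) []          = z≤n
  length-spokes (u ∷ us) (a ∷ [])    = z≤n
  length-spokes (u ∷ us) (a ∷ b ∷ L) =
    ≤-trans (s≤s (s≤s (length-spokes us L))) (≤-reflexive (sym (*-suc 2 (length us))))

  private
    pairs-left : ∀ {l k} → suc (suc l) ≡ 2 * suc k → l ≡ 2 * k
    pairs-left {l} {k} eq = suc-injective (suc-injective (trans eq (*-suc 2 k)))

    1≢2*suc : ∀ {k} → 1 ≢ 2 * suc k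
    1≢2*suc {k} eq with trans eq (*-suc 2 k)
    ... | ()

  spokes-hub : ∀ us L → Unique L → length L ≡ 2 * length us → ∀ {u} → u ∈ us →
               ∃₂ λ c d → c ≢ d × inj₂ (crossEdge c u) ∈ spokes us L × inj₂ (crossEdge d u) ∈ spokes us L
  spokes-hub (u ∷ us) (a ∷ b ∷ L) ((a≢b ∷ _) ∷ _) _ (here refl) = a , b , a≢b , here refl , there (here refl)
  spokes-hub (_ ∷ us) (a ∷ b ∷ L) (_ ∷ _ ∷ !L) eq (there u∈us) with spokes-hub us L !L (pairs-left eq) u∈us
  ... | c , d , c≢d , c∈ , d∈ = c , d , c≢d , there (there c∈) , there (there d∈)
  spokes-hub (_ ∷ _) (_ ∷ []) _ eq _ = ⊥-elim (1≢2*suc eq)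

  spokes-rim : ∀ us L → length L ≡ 2 * length us → ∀ {a} → a ∈ L →
               ∃ λ u → inj₂ (crossEdge a u) ∈ spokes us L
  spokes-rim (u ∷ us) (a ∷ b ∷ L) _  (here refl)         = u , here refl
  spokes-rim (u ∷ us) (a ∷ b ∷ L) _  (there (here refl)) = u , there (here refl)
  spokes-rim (u ∷ us) (a ∷ b ∷ L) eq (there (there a∈L)) with spokes-rim us L (pairs-left eq) a∈L
  ... | v , a∈ = v , there (there a∈)
  spokes-rim (_ ∷ _) (_ ∷ []) eq _ = ⊥-elim (1≢2*suc eq)

  module Cover {m : ℕ} (f : Fin m → Fin n) (f-injective : Injective _≡_ _≡_ f) (m+2p≡n : m + 2 * p ≡ n)
               (S′ : List (Fin m ⊎ Edge (Induced G f))) (dom′ : TotallyDominates (Middle (Induced G f)) S′) where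

    open ImageComplement f f-injective

    ι : Fin m → Fin (n + p)
    ι i = f i ↑ˡ p

    ι-injective : Injective _≡_ _≡_ ι
    ι-injective = f-injective ∘ FP.↑ˡ-injective p _ _

    ι-adj : ∀ {i j} → Adj (Induced G f) i j → Adj G+K̄p (ι i) (ι j)
    ι-adj {i} {j} = subst T (sym (joinAdj-↑ˡ (f i) (f j)))

    ι-adj⁻ : ∀ {i j} → Adj G+K̄p (ι i) (ι j) → Adj (Induced G f) i j
    ι-adj⁻ {i} {j} = subst T (joinAdj-↑ˡ (f i) (f j))

    open EdgeMap (Induced G f) G+K̄p ι ι-injective ι-adj

    length-complement≡2p : length complement ≡ 2 * length (allFin p)
    length-complement≡2p = trans (+-cancelˡ-≡ m _ _ (trans length-complement (sym m+2p≡n)))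
                               (cong (2 *_) (sym (length-tabulate {n = p} id)))

    crossCover : List (Fin (n + p) ⊎ Edge G+K̄p)
    crossCover = spokes (allFin p) complement

    cover : List (Fin (n + p) ⊎ Edge G+K̄p)
    cover = map mapMiddle S′ ++ crossCover

    hub-spokes : ∀ u → ∃₂ λ c d → c ≢ d × inj₂ (crossEdge c u) ∈ crossCover × inj₂ (crossEdge d u) ∈ crossCover
    hub-spokes u = spokes-hub (allFin p) complement complement-unique length-complement≡2p (∈-allFin u)

    rim-spoke : ∀ {a} → ¬ Image a → ∃ λ u → inj₂ (crossEdge a u) ∈ crossCover
    rim-spoke a∉f = spokes-rim (allFin p) complement length-complement≡2p (∈-complement a∉f)

    Dominated : Fin (n + p) ⊎ Edge G+K̄p → Set
    Dominated s = ∃ λ t → t ∈ cover × MAdj G+K̄p s t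

    image-dominated : ∀ s → Dominated (mapMiddle s)
    image-dominated s with dom′ s
    ... | t , t∈S′ , st = mapMiddle t , ∈-++⁺ˡ (∈-map⁺ mapMiddle t∈S′) , mapMiddle-adj s t st

    spoke∈cover : ∀ {s} → s ∈ crossCover → s ∈ cover
    spoke∈cover = ∈-++⁺ʳ (map mapMiddle S′)

    hub-edge-dominated : ∀ e u → (n ↑ʳ u) ∈ₑ e → Dominated (inj₂ e)
    hub-edge-dominated e u u∈e with hub-spokes u
    ... | c , d , c≢d , c∈ , d∈ with crossEdge c u ≟ᴱ e
    ... | no  c≢e  = inj₂ (crossEdge c u) , spoke∈cover c∈ , c≢e ∘ edge-≡ _ _ ∘ sym , n ↑ʳ u , u∈e , inj₂ refl
    ... | yes refl = inj₂ (crossEdge d u) , spoke∈cover d∈ , c≢d ∘ FP.↑ˡ-injective p c d ∘ cong proj₁ ,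
                     n ↑ʳ u , u∈e , inj₂ refl

    rim-edge-dominated : ∀ {a b} (a<b : (a ↑ˡ p) <ᶠ (b ↑ˡ p)) ab {c} → ¬ Image c →
                         let e = (a ↑ˡ p , b ↑ˡ p) , a<b , ab in (c ↑ˡ p) ∈ₑ e → Dominated (inj₂ e)
    rim-edge-dominated {b = b} a<b ab c∉f c∈e with rim-spoke c∉f
    ... | u , c∈ = inj₂ (crossEdge _ u) , spoke∈cover c∈ , ↑ˡ≢↑ʳ b u ∘ cong proj₂ , _ , c∈e , inj₁ refl

    inner-edge-dominated : ∀ i j (ι<ι : ι i <ᶠ ι j) ij → Dominated (inj₂ ((ι i , ι j) , ι<ι , ij))
    inner-edge-dominated i j ι<ι ij = subst (Dominated ∘ inj₂) image≡e (image-dominated (inj₂ e′))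
      where
      open Edges (Induced G f) using (edgeBetween; edgeBetween-end⁺)
      e′ : Edge (Induced G f)
      e′ = edgeBetween i j (ι-adj⁻ ij)
      image≡e : mapEdge e′ ≡ ((ι i , ι j) , ι<ι , ij)
      image≡e = edge-unique _ _ (λ ιi≡ιj → FP.<-irrefl ιi≡ιj ι<ι)
        (mapEdge-end e′ (edgeBetween-end⁺ i j _ (inj₁ refl)))
        (mapEdge-end e′ (edgeBetween-end⁺ i j _ (inj₂ refl)))
        (inj₁ refl) (inj₂ refl)

    vertex-dominated : ∀ x → Dominated (inj₁ x)
    vertex-dominated x with split n p x
    ... | inʳ u with hub-spokes u
    ...   | c , _ , _ , c∈ , _ = inj₂ (crossEdge c u) , spoke∈cover c∈ , inj₂ refl
    vertex-dominated x | inˡ a with image? a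
    ... | yes (i , refl) = image-dominated (inj₁ i)
    ... | no  a∉f with rim-spoke a∉f
    ...   | u , a∈ = inj₂ (crossEdge a u) , spoke∈cover a∈ , inj₁ refl

    edge-dominated : ∀ e → Dominated (inj₂ e)
    edge-dominated ((x , y) , x<y , xy) with split n p x | split n p y
    ... | inʳ u | _     = hub-edge-dominated _ u (inj₁ refl)
    ... | inˡ a | inʳ u = hub-edge-dominated _ u (inj₂ refl)
    ... | inˡ a | inˡ b with image? a | image? b
    ...   | no  a∉f        | _              = rim-edge-dominated x<y xy a∉f (inj₁ refl)
    ...   | yes _          | no  b∉f        = rim-edge-dominated x<y xy b∉f (inj₂ refl)
    ...   | yes (i , refl) | yes (j , refl) = inner-edge-dominated i j x<y xy

    cover-dominates : TotallyDominates (Middle G+K̄p) cover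
    cover-dominates (inj₁ x) = vertex-dominated x
    cover-dominates (inj₂ e) = edge-dominated e

    length-cover : length cover ≤ length S′ + 2 * p
    length-cover = begin
      length cover                                  ≡⟨ length-++ (map mapMiddle S′) ⟩
      length (map mapMiddle S′) + length crossCover ≡⟨ cong (_+ length crossCover) (length-map mapMiddle S′) ⟩
      length S′ + length crossCover                 ≤⟨ +-monoʳ-≤ (length S′) (length-spokes (allFin p) complement) ⟩
      length S′ + 2 * length (allFin p)             ≡⟨ cong (λ k → length S′ + 2 * k) (length-tabulate {n = p} id) ⟩
      length S′ + 2 * p                             ∎
      where open Data.Nat.Properties.≤-Reasoning

middle-join-cover : ∀ {n m} (G : SimpleGraph n) p (f : Fin m → Fin n) → Injective _≡_ _≡_ f → m + 2 * p ≡ n →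
                    ∀ S′ → TotallyDominates (Middle (Induced G f)) S′ →
                    ∃ λ T → TotallyDominates (Middle (JoinEmpty G p)) T × length T ≤ length S′ + 2 * p
middle-join-cover G p f f-injective m+2p≡n S′ dom′ = cover , cover-dominates , length-cover
  where open JoinCover.Cover G p f f-injective m+2p≡n S′ dom′

ceil/3-≤ : ∀ {a k} → a ≤ 3 * k → ceil/3 a ≤ k
ceil/3-≤ {a} {k} a≤3k = ≤-pred (m<n*o⇒m/o<n (begin-strict
  a + 2       ≤⟨ +-monoˡ-≤ 2 a≤3k ⟩
  3 * k + 2   ≡⟨ +-comm (3 * k) 2 ⟩
  2 + 3 * k   ≡⟨ cong (2 +_) (*-comm 3 k) ⟩
  2 + k * 3   <⟨ n<1+n (2 + k * 3) ⟩
  suc k * 3   ∎))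
  where open Data.Nat.Properties.≤-Reasoning

theorem4p10 : (n p : ℕ) (G : SimpleGraph n) → Connected G → 2 ≤ n →
    1 ≤ p → 2 * p + 2 ≤ n →
    (k : ℕ) → IsGammaT (Middle (JoinEmpty G p)) k →
    (ceil/3 (2 * (n + p)) ≤ k)
    × ((f : Fin (n ∸ 2 * p) → Fin n) → Injective _≡_ _≡_ f →
       NoIsolated (Induced G f) →
       (k' : ℕ) → IsGammaT (Middle (Induced G f)) k' → k ≤ 2 * p + k')
theorem4p10 n p G _ _ _ 2p+2≤n k γ@((S , (_ , S-dom) , |S|≡k) , _) = lower , upper
  where
  2p≤n : 2 * p ≤ n
  2p≤n = ≤-trans (m≤m+n (2 * p) 2) 2p+2≤n

  lower : ceil/3 (2 * (n + p)) ≤ k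
  lower = ceil/3-≤ (subst (λ l → 2 * (n + p) ≤ 3 * l) |S|≡k
                           (middle-domination-lower-bound (JoinEmpty G p) S S-dom))

  upper : (f : Fin (n ∸ 2 * p) → Fin n) → Injective _≡_ _≡_ f → NoIsolated (Induced G f) →
          (k′ : ℕ) → IsGammaT (Middle (Induced G f)) k′ → k ≤ 2 * p + k′
  upper f f-injective _ k′ ((S′ , (_ , S′-dom) , |S′|≡k′) , _)
    with T , T-dom , |T|≤ ← middle-join-cover G p f f-injective (m∸n+n≡m 2p≤n) S′ S′-dom
    = begin
      k                   ≤⟨ γₜ≤length γ (Edges._≟ᴹ_ (JoinEmpty G p)) T T-dom ⟩
      length T            ≤⟨ |T|≤ ⟩
      length S′ + 2 * p   ≡⟨ cong (_+ 2 * p) |S′|≡k′ ⟩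
      k′ + 2 * p          ≡⟨ +-comm k′ (2 * p) ⟩
      2 * p + k′          ∎
    where open Data.Nat.Properties.≤-Reasoning
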